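{- Let $a,b$ be relatively prime integers with $1<a<b$, let $S=\langle a,b\rangle$, and let $(u,v)$ be the definitely least solution of $ax+by=1$. If $I_{i,a}(S)\neq\varnothing$ for some $i\in[1,a-1]$ and $h_i=\min I_{i,a}(S)$, then \[I_{i,a}(S)=\{h_i,\ h_i+a,\ \dots,\ h_i+(|u|-1)a\}.\]
   Context: $\langle a,b\rangle=\{\lambda_1a+\lambda_2b:\lambda_1,\lambda_2\in\mathbb{N}\}$. $I(S)$ is the set of isolated gaps of $S$ (elements $x\in\mathbb{N}\setminus S$ with $x-1,x+1\in S$). For $i\in\{1,\dots,a-1\}$, $I_{i,a}(S)=\{s\in I(S): s\equiv i\pmod a\}$. The definitely least solution $(u,v)$ of $ax+by=1$ is the integer solution for which both $|u|$ and $|v|$ are least possible; it is unique, and is the unique solution with $|u|\le b/2$, $|v|\le a/2$. -}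

module Defs where

open import Data.Nat using (ℕ; suc; _+_; _*_; _<_; _≤_; _%_; NonZero)
open import Data.Nat.Coprimality using (Coprime)
open import Data.Integer as ℤ using (ℤ; +_; ∣_∣)
open import Data.Product using (Σ; ∃; ∃-syntax; _×_; _,_)
open import Relation.Nullary using (¬_)
open import Relation.Binary.PropositionalEquality using (_≡_)

_∈⟨_,_⟩ : ℕ → ℕ → ℕ → Set
n ∈⟨ a , b ⟩ = ∃[ l₁ ] ∃[ l₂ ] n ≡ l₁ * a + l₂ * b

-- isolated gap of ⟨ a , b ⟩ : x ∉ S with x - 1 ∈ S and x + 1 ∈ S
-- (x - 1 ∈ ℕ forces x ≥ 1, so we write x = suc y with y = x - 1)
IsolatedGap : ℕ → ℕ → ℕ → Set
IsolatedGap a b x =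
  ∃[ y ] (x ≡ suc y) × (y ∈⟨ a , b ⟩) × ¬ (x ∈⟨ a , b ⟩) × (suc x ∈⟨ a , b ⟩)

InI : (i a b : ℕ) .{{_ : NonZero a}} → ℕ → Set
InI i a b x = IsolatedGap a b x × (x % a ≡ i % a)

IsSolution : ℕ → ℕ → ℤ → ℤ → Set
IsSolution a b u v = (+ a) ℤ.* u ℤ.+ (+ b) ℤ.* v ≡ + 1

DefinitelyLeast : ℕ → ℕ → ℤ → ℤ → Set
DefinitelyLeast a b u v =
  IsSolution a b u v ×
  (∀ u′ v′ → IsSolution a b u′ v′ → (∣ u ∣ ≤ ∣ u′ ∣) × (∣ v ∣ ≤ ∣ v′ ∣))

{-# OPTIONS --safe #-}
-- Let q = ∣v∣, so that q b and p a, with p = ∣u∣, differ by one; minimality of ∣u∣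
-- against the solutions u ± b gives 2p ≤ b.  Every n ∈ S is uniquely l a + c b with
-- c < a, and n + m a = l a + c b with c < a forces n ∉ S exactly when l < m.
-- For the least isolated gap h of its class, one neighbour w of h satisfies
-- h + p a = w + q b.  Writing w = l a + c b canonically, h ∉ S forces l < p and
-- c + q < a.  If l ≥ 1, the other neighbour z, with z + 2p a = w + 2q b, also
-- exceeds a by an element of S, so h − a would be a smaller isolated gap of the same
-- class.  Hence h + p a = c b with c < a, and h + k a is a gap exactly for k < p
-- while its neighbours stay in S.
module Submission where

open import Defs
open import Data.Nat using (ℕ; zero; suc; _+_; _*_; _<_; _≤_; _∸_; _%_; _/_; NonZero; s≤s; z<s; >-nonZero⁻¹)
open import Data.Nat.Properties
open import Data.Nat.DivMod using (m≡m%n+[m/n]*n; m%n<n; [m+kn]%n≡m%n; /-monoˡ-≤)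
open import Data.Nat.Divisibility using (_∣_; >⇒∤; ∣m+n∣m⇒∣n; n∣m*n)
open import Data.Nat.Coprimality using (Coprime; coprime-divisor)
open import Data.Nat.Tactic.RingSolver using (solve)
open import Data.Integer as ℤ using (ℤ; +_; -[1+_]; ∣_∣; _⊖_; 1ℤ)
import Data.Integer.Properties as ℤ
import Data.Integer.Tactic.RingSolver as ℤ-Solver
open import Data.List using (_∷_; [])
open import Data.Product using (∃-syntax; _×_; _,_; proj₁; proj₂)
open import Data.Sum using (_⊎_; inj₁; inj₂)
open import Data.Empty using (⊥; ⊥-elim)
open import Relation.Nullary using (¬_; contradiction)
open import Relation.Binary.PropositionalEquality
  using (_≡_; refl; sym; trans; cong; subst; subst₂; module ≡-Reasoning)
open import Function.Bundles using (_⇔_; mk⇔)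
open ≡-Reasoning

same-residue⇒≡+* : ∀ {m n} d .{{_ : NonZero d}} → m ≤ n → n % d ≡ m % d → ∃[ k ] n ≡ m + k * d
same-residue⇒≡+* {m} {n} d m≤n n%d≡m%d = k , (begin
  n                          ≡⟨ m≡m%n+[m/n]*n n d ⟩
  n % d + n / d * d          ≡⟨ cong (_+_ (n % d)) (cong (_* d) (sym (m+[n∸m]≡n (/-monoˡ-≤ d m≤n)))) ⟩
  n % d + (m / d + k) * d    ≡⟨ cong (_+ (m / d + k) * d) n%d≡m%d ⟩
  m % d + (m / d + k) * d    ≡⟨ cong (_+_ (m % d)) (*-distribʳ-+ d (m / d) k) ⟩
  m % d + (m / d * d + k * d) ≡⟨ sym (+-assoc (m % d) (m / d * d) (k * d)) ⟩
  m % d + m / d * d + k * d  ≡⟨ cong (_+ k * d) (sym (m≡m%n+[m/n]*n m d)) ⟩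
  m + k * d                  ∎)
  where
  k : ℕ
  k = n / d ∸ m / d

m⊖[1+n]≡1⇒m≡2+n : ∀ {m n} → m ⊖ suc n ≡ 1ℤ → m ≡ suc (suc n)
m⊖[1+n]≡1⇒m≡2+n {m} {n} eq = ℤ.+-injective (begin
  + m                           ≡⟨ i≡i+j-j (+ m) -[1+ n ] ⟩
  + m ℤ.+ -[1+ n ] ℤ.- -[1+ n ] ≡⟨ cong (ℤ._- -[1+ n ]) eq ⟩
  + suc (suc n)                 ∎)
  where
  i≡i+j-j : ∀ i j → i ≡ i ℤ.+ j ℤ.- j
  i≡i+j-j = ℤ-Solver.solve-∀

+≡1⇒∣∣-adjacent : ∀ i j → i ℤ.+ j ≡ 1ℤ → ∣ i ∣ ≡ suc ∣ j ∣ ⊎ ∣ j ∣ ≡ suc ∣ i ∣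
+≡1⇒∣∣-adjacent (+ 0)           (+ 1)           _  = inj₂ refl
+≡1⇒∣∣-adjacent (+ 1)           (+ 0)           _  = inj₁ refl
+≡1⇒∣∣-adjacent (+ 0)           (+ 0)           ()
+≡1⇒∣∣-adjacent (+ 0)           (+ suc (suc _)) ()
+≡1⇒∣∣-adjacent (+ 1)           (+ suc _)       ()
+≡1⇒∣∣-adjacent (+ suc (suc _)) (+ _)           ()
+≡1⇒∣∣-adjacent (+ _)           -[1+ _ ]        eq = inj₁ (m⊖[1+n]≡1⇒m≡2+n eq)
+≡1⇒∣∣-adjacent -[1+ m ]        (+ n)           eq = inj₂ (m⊖[1+n]≡1⇒m≡2+n (trans (ℤ.+-comm (+ n) -[1+ m ]) eq))
+≡1⇒∣∣-adjacent -[1+ _ ]        -[1+ _ ]        ()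

∣+n*i∣≡∣i∣*n : ∀ n i → ∣ + n ℤ.* i ∣ ≡ ∣ i ∣ * n
∣+n*i∣≡∣i∣*n n i = trans (ℤ.abs-* (+ n) i) (*-comm n ∣ i ∣)

solution⇒adjacent : ∀ a b u v → IsSolution a b u v →
                    ∣ v ∣ * b ≡ suc (∣ u ∣ * a) ⊎ ∣ u ∣ * a ≡ suc (∣ v ∣ * b)
solution⇒adjacent a b u v sol with +≡1⇒∣∣-adjacent (+ a ℤ.* u) (+ b ℤ.* v) sol
... | inj₁ au≡1+bv = inj₂ (subst₂ (λ s t → s ≡ suc t) (∣+n*i∣≡∣i∣*n a u) (∣+n*i∣≡∣i∣*n b v) au≡1+bv)
... | inj₂ bv≡1+au = inj₁ (subst₂ (λ s t → s ≡ suc t) (∣+n*i∣≡∣i∣*n b v) (∣+n*i∣≡∣i∣*n a u) bv≡1+au)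

shifted-solutions : ∀ a b u v → IsSolution a b u v →
                    IsSolution a b (u ℤ.- + b) (v ℤ.+ + a) × IsSolution a b (u ℤ.+ + b) (v ℤ.- + a)
shifted-solutions a b u v sol = trans (shift-down (+ a) (+ b) u v) sol , trans (shift-up (+ a) (+ b) u v) sol
  where
  shift-down : ∀ A B U V → A ℤ.* (U ℤ.- B) ℤ.+ B ℤ.* (V ℤ.+ A) ≡ A ℤ.* U ℤ.+ B ℤ.* V
  shift-down = ℤ-Solver.solve-∀
  shift-up : ∀ A B U V → A ℤ.* (U ℤ.+ B) ℤ.+ B ℤ.* (V ℤ.- A) ≡ A ℤ.* U ℤ.+ B ℤ.* V
  shift-up = ℤ-Solver.solve-∀

m≤∣m⊖n∣⇒m+m≤n : ∀ {m n} → 0 < n → m ≤ ∣ m ⊖ n ∣ → m + m ≤ n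
m≤∣m⊖n∣⇒m+m≤n {m} {n} 0<n m≤∣m⊖n∣ with ≤-total m n
... | inj₁ m≤n = subst (m + m ≤_) (m∸n+n≡m m≤n) (+-monoˡ-≤ m (subst (m ≤_) (ℤ.∣⊖∣-≤ m≤n) m≤∣m⊖n∣))
... | inj₂ n≤m = contradiction (subst (m ≤_) ∣m⊖n∣≡m∸n m≤∣m⊖n∣) (<⇒≱ (∸-monoʳ-< 0<n n≤m))
  where
  ∣m⊖n∣≡m∸n : ∣ m ⊖ n ∣ ≡ m ∸ n
  ∣m⊖n∣≡m∸n = trans (ℤ.∣m⊖n∣≡∣n⊖m∣ m n) (ℤ.∣⊖∣-≤ n≤m)

∣i∣≤∣i∓n∣⇒∣i∣+∣i∣≤n : ∀ i {n} → 0 < n → ∣ i ∣ ≤ ∣ i ℤ.- + n ∣ → ∣ i ∣ ≤ ∣ i ℤ.+ + n ∣ → ∣ i ∣ + ∣ i ∣ ≤ n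
∣i∣≤∣i∓n∣⇒∣i∣+∣i∣≤n (+ m)    {n} 0<n le _ =
  m≤∣m⊖n∣⇒m+m≤n 0<n (subst (m ≤_) (cong ∣_∣ (ℤ.m-n≡m⊖n m n)) le)
∣i∣≤∣i∓n∣⇒∣i∣+∣i∣≤n -[1+ m ] {n} 0<n _ le =
  m≤∣m⊖n∣⇒m+m≤n 0<n (subst (suc m ≤_) (ℤ.∣m⊖n∣≡∣n⊖m∣ n (suc m)) le)

neighbour-shifts-below : ∀ {y P Q} → Q ≡ suc P →
                         suc y + P ≡ y + Q × suc (suc y) + (P + P) ≡ y + (Q + Q)
neighbour-shifts-below {y} {P} refl = solve (y ∷ P ∷ []) , solve (y ∷ P ∷ [])

neighbour-shifts-above : ∀ {y P Q} → P ≡ suc Q →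
                         suc y + P ≡ suc (suc y) + Q × y + (P + P) ≡ suc (suc y) + (Q + Q)
neighbour-shifts-above {y} {Q = Q} refl = solve (y ∷ Q ∷ []) , solve (y ∷ Q ∷ [])

module TwoGenerated (a b : ℕ) .{{_ : NonZero a}} (coprime : Coprime a b) where

  _∈S : ℕ → Set
  n ∈S = n ∈⟨ a , b ⟩

  +-*a-∈S : ∀ {n} k → n ∈S → (n + k * a) ∈S
  +-*a-∈S k (l , c , refl) = l + k , c , solve (l ∷ c ∷ k ∷ a ∷ b ∷ [])

  canonical : ∀ {n} → n ∈S → ∃[ l ] ∃[ c ] c < a × n ≡ l * a + c * b
  canonical (l , m , refl) = l + m / a * b , m % a , m%n<n m a , (begin
    l * a + m * b                    ≡⟨ cong (λ t → l * a + t * b) (m≡m%n+[m/n]*n m a) ⟩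
    l * a + (m % a + m / a * a) * b  ≡⟨ regroup l (m % a) (m / a) ⟩
    (l + m / a * b) * a + m % a * b  ∎)
    where
    regroup : ∀ l r d → l * a + (r + d * a) * b ≡ (l + d * b) * a + r * b
    regroup l r d = solve (l ∷ r ∷ d ∷ a ∷ b ∷ [])

  a∣*b⇒≡0 : ∀ {d} → d < a → a ∣ d * b → d ≡ 0
  a∣*b⇒≡0 {zero}  _   _    = refl
  a∣*b⇒≡0 {suc d} d<a a∣db =
    contradiction (coprime-divisor coprime (subst (a ∣_) (*-comm (suc d) b) a∣db)) (>⇒∤ d<a)

  canonical-unique-≤ : ∀ {l c l′ d} → l * a + c * b ≡ l′ * a + (c + d) * b → c + d < a → l ≡ l′
  canonical-unique-≤ {l} {c} {l′} {d} eq c+d<a = *-cancelʳ-≡ l l′ a (begin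
    l * a           ≡⟨ la≡l′a+db ⟩
    l′ * a + d * b  ≡⟨ cong (λ t → l′ * a + t * b) d≡0 ⟩
    l′ * a + 0      ≡⟨ +-identityʳ (l′ * a) ⟩
    l′ * a          ∎)
    where
    la≡l′a+db : l * a ≡ l′ * a + d * b
    la≡l′a+db = +-cancelʳ-≡ (c * b) (l * a) (l′ * a + d * b) (begin
      l * a + c * b              ≡⟨ eq ⟩
      l′ * a + (c + d) * b       ≡⟨ solve (l′ ∷ c ∷ d ∷ a ∷ b ∷ []) ⟩
      l′ * a + d * b + c * b     ∎)
    d≡0 : d ≡ 0
    d≡0 = a∣*b⇒≡0 (≤-<-trans (m≤n+m d c) c+d<a) (∣m+n∣m⇒∣n (subst (a ∣_) la≡l′a+db (n∣m*n l)) (n∣m*n l′))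

  canonical-unique : ∀ {l c l′ c′} → l * a + c * b ≡ l′ * a + c′ * b → c < a → c′ < a → l ≡ l′
  canonical-unique {l} {c} {l′} {c′} eq c<a c′<a with ≤-total c c′
  ... | inj₁ c≤c′ with d , refl ← m≤n⇒∃[o]m+o≡n c≤c′ = canonical-unique-≤ {l} {c} {l′} {d} eq c′<a
  ... | inj₂ c′≤c with d , refl ← m≤n⇒∃[o]m+o≡n c′≤c = sym (canonical-unique-≤ {l′} {c′} {l} {d} (sym eq) c<a)

  canonical-<⇒∉S : ∀ {n} m l c → n + m * a ≡ l * a + c * b → c < a → l < m → ¬ n ∈S
  canonical-<⇒∉S {n} m l c eq c<a l<m n∈S with l₀ , c₀ , c₀<a , refl ← canonical n∈S =
    <⇒≱ l<m (subst (m ≤_) (canonical-unique eq′ c₀<a c<a) (m≤n+m m l₀))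
    where
    eq′ : (l₀ + m) * a + c₀ * b ≡ l * a + c * b
    eq′ = begin
      (l₀ + m) * a + c₀ * b   ≡⟨ solve (l₀ ∷ m ∷ c₀ ∷ a ∷ b ∷ []) ⟩
      l₀ * a + c₀ * b + m * a ≡⟨ eq ⟩
      l * a + c * b           ∎

  trade-b-for-a : ∀ {n} m l c → n + m * a ≡ l * a + c * b → a ≤ c → m ≤ b →
                  ∃[ f ] ∃[ e ] n ≡ (l + f) * a + e * b
  trade-b-for-a {n} m l c eq a≤c m≤b
    with e , refl ← m≤n⇒∃[o]m+o≡n a≤c
    with f , m+f≡b ← m≤n⇒∃[o]m+o≡n m≤b =
    f , e , +-cancelʳ-≡ (m * a) n ((l + f) * a + e * b) (begin
      n + m * a                    ≡⟨ eq ⟩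
      l * a + (a + e) * b          ≡⟨ solve (l ∷ a ∷ e ∷ b ∷ []) ⟩
      (l + b) * a + e * b          ≡⟨ cong (λ t → (l + t) * a + e * b) (sym m+f≡b) ⟩
      (l + (m + f)) * a + e * b    ≡⟨ solve (l ∷ m ∷ f ∷ a ∷ e ∷ b ∷ []) ⟩
      (l + f) * a + e * b + m * a  ∎)

  cancel-*a-∈S : ∀ {n} m l c → n + m * a ≡ l * a + c * b → m ≤ l → n ∈S
  cancel-*a-∈S {n} m l c eq m≤l with g , refl ← m≤n⇒∃[o]m+o≡n m≤l =
    g , c , +-cancelʳ-≡ (m * a) n (g * a + c * b) (begin
      n + m * a              ≡⟨ eq ⟩
      (m + g) * a + c * b    ≡⟨ solve (m ∷ g ∷ a ∷ c ∷ b ∷ []) ⟩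
      g * a + c * b + m * a  ∎)

  ∉S⇒canonical-< : ∀ {n} m l c → ¬ n ∈S → n + m * a ≡ l * a + c * b → m ≤ b → c < a × l < m
  ∉S⇒canonical-< {n} m l c n∉S eq m≤b =
    ≰⇒> (λ a≤c → let f , e , n≡ = trade-b-for-a m l c eq a≤c m≤b in n∉S (l + f , e , n≡)) ,
    ≰⇒> (λ m≤l → n∉S (cancel-*a-∈S m l c eq m≤l))

  ∈S⇒canonical-≥ : ∀ {n} m l c → n ∈S → n + m * a ≡ l * a + c * b → l < m → m ≤ b →
                   ∃[ f ] ∃[ e ] n ≡ (l + f) * a + e * b
  ∈S⇒canonical-≥ {n} m l c n∈S eq l<m m≤b =
    trade-b-for-a {n} m l c eq (≮⇒≥ (λ c<a → canonical-<⇒∉S m l c eq c<a l<m n∈S)) m≤b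

  -- c b with c < a is the least element of S in its residue class modulo a, so for
  -- a gap h the depth p is the least k with h + k a ∈ S.
  Depth : ℕ → ℕ → Set
  Depth h p = ∃[ c ] c < a × h + p * a ≡ c * b

  below-depth-∉S : ∀ {h p k} → Depth h p → k < p → ¬ (h + k * a) ∈S
  below-depth-∉S {h} {p} {k} (c , c<a , h+pa≡cb) k<p with d , 1+k+d≡p ← m≤n⇒∃[o]m+o≡n k<p =
    canonical-<⇒∉S (suc d) 0 c (begin
      h + k * a + suc d * a  ≡⟨ solve (h ∷ k ∷ d ∷ a ∷ []) ⟩
      h + (suc k + d) * a    ≡⟨ cong (λ t → h + t * a) 1+k+d≡p ⟩
      h + p * a              ≡⟨ h+pa≡cb ⟩
      c * b                  ∎) c<a z<s

  beyond-depth-∈S : ∀ {h p k} → Depth h p → p ≤ k → (h + k * a) ∈S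
  beyond-depth-∈S {h} {p} {k} (c , _ , h+pa≡cb) p≤k with g , refl ← m≤n⇒∃[o]m+o≡n p≤k =
    g , c , (begin
      h + (p + g) * a      ≡⟨ solve (h ∷ p ∷ g ∷ a ∷ []) ⟩
      h + p * a + g * a    ≡⟨ cong (_+ g * a) h+pa≡cb ⟩
      c * b + g * a        ≡⟨ +-comm (c * b) (g * a) ⟩
      g * a + c * b        ∎)

  Lowest : ℕ → ℕ → Set
  Lowest i h = InI i a b h × (∀ x → InI i a b x → h ≤ x)

  lowest-no-lower-neighbours : ∀ {i y y′ z′} → Lowest i (suc y) →
                               y ≡ a + y′ → suc (suc y) ≡ a + z′ → y′ ∈S → z′ ∈S → ⊥
  lowest-no-lower-neighbours {i} {y} {y′} {z′} (((_ , refl , _ , h∉S , _) , h%a) , lowest) refl z≡ y′∈S z′∈S =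
    <⇒≱ x<h (lowest x ((y′ , refl , y′∈S , x∉S , subst _∈S z′≡2+y′ z′∈S) , x%a))
    where
    x : ℕ
    x = suc y′
    h≡x+a : suc (a + y′) ≡ suc y′ + 1 * a
    h≡x+a = solve (a ∷ y′ ∷ [])
    x<h : x < suc (a + y′)
    x<h = s≤s (m<n+m y′ (>-nonZero⁻¹ a))
    x∉S : ¬ x ∈S
    x∉S x∈S = h∉S (subst _∈S (sym h≡x+a) (+-*a-∈S 1 x∈S))
    z′≡2+y′ : z′ ≡ suc x
    z′≡2+y′ = +-cancelˡ-≡ a z′ (suc x) (begin
      a + z′                ≡⟨ sym z≡ ⟩
      suc (suc (a + y′))    ≡⟨ solve (a ∷ y′ ∷ []) ⟩
      a + suc (suc y′)      ∎)
    x%a : x % a ≡ i % a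
    x%a = begin
      x % a          ≡⟨ sym ([m+kn]%n≡m%n x 1 a) ⟩
      (x + 1 * a) % a ≡⟨ cong (_% a) (sym h≡x+a) ⟩
      suc (a + y′) % a ≡⟨ h%a ⟩
      i % a          ∎

  absorb-*b : ∀ {x w} j l c → x ≡ w + j * b → w ≡ l * a + c * b → x ≡ l * a + (c + j) * b
  absorb-*b {x} j l c eq refl = begin
    x                       ≡⟨ eq ⟩
    l * a + c * b + j * b   ≡⟨ solve (l ∷ c ∷ j ∷ a ∷ b ∷ []) ⟩
    l * a + (c + j) * b     ∎

  depth-from-neighbours : ∀ {h w z} p q → w ∈S → z ∈S → ¬ h ∈S → p + p ≤ b →
    h + p * a ≡ w + q * b → z + (p * a + p * a) ≡ w + (q * b + q * b) →
    (∀ {w′ z′} → w ≡ a + w′ → z ≡ a + z′ → w′ ∈S → z′ ∈S → ⊥) → Depth h p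
  depth-from-neighbours {h} {w} {z} p q w∈S z∈S h∉S 2p≤b h-eq z-eq no-lower-pair
    with canonical w∈S
  ... | zero , c , _ , w≡ =
    c + q , proj₁ (∉S⇒canonical-< p 0 (c + q) h∉S h-eq′ (m+n≤o⇒m≤o p 2p≤b)) , h-eq′
    where
    h-eq′ : h + p * a ≡ (c + q) * b
    h-eq′ = absorb-*b q 0 c h-eq w≡
  ... | suc l′ , c , _ , w≡
    with _ , l<p ← ∉S⇒canonical-< p (suc l′) (c + q) h∉S (absorb-*b q (suc l′) c h-eq w≡) (m+n≤o⇒m≤o p 2p≤b)
    with z-eq′ ← subst₂ (λ s t → z + s ≡ w + t) (sym (*-distribʳ-+ a p p)) (sym (*-distribʳ-+ b q q)) z-eq
    with f , e , z≡ ← ∈S⇒canonical-≥ (p + p) (suc l′) (c + (q + q)) z∈S (absorb-*b (q + q) (suc l′) c z-eq′ w≡)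
                                     (<-≤-trans l<p (m≤m+n p p)) 2p≤b =
    ⊥-elim (no-lower-pair (trans w≡ (+-assoc a (l′ * a) (c * b))) (trans z≡ (+-assoc a ((l′ + f) * a) (e * b)))
                  (l′ , c , refl) (l′ + f , e , refl))

  lowest-depth : ∀ {i h} p q → Lowest i h → q * b ≡ suc (p * a) ⊎ p * a ≡ suc (q * b) → p + p ≤ b →
                 Depth h p
  lowest-depth p q lowest@(((y , refl , y∈S , h∉S , h+1∈S) , _) , _) (inj₁ qb≡1+pa) 2p≤b =
    let h-eq , z-eq = neighbour-shifts-below {y} qb≡1+pa in
    depth-from-neighbours p q y∈S h+1∈S h∉S 2p≤b h-eq z-eq (lowest-no-lower-neighbours lowest)
  lowest-depth p q lowest@(((y , refl , y∈S , h∉S , h+1∈S) , _) , _) (inj₂ pa≡1+qb) 2p≤b =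
    let h-eq , z-eq = neighbour-shifts-above {y} pa≡1+qb in
    depth-from-neighbours p q h+1∈S y∈S h∉S 2p≤b h-eq z-eq
      (λ w≡ z≡ w′∈S z′∈S → lowest-no-lower-neighbours lowest z≡ w≡ z′∈S w′∈S)

  lowest-isolated-gaps : ∀ {i h p} → Lowest i h → Depth h p →
                         ∀ x → InI i a b x ⇔ (∃[ k ] k < p × x ≡ h + k * a)
  lowest-isolated-gaps {i} {_} {p} (((y , refl , y∈S , _ , h+1∈S) , h%a) , lowest) depth x = mk⇔ to from
    where
    to : InI i a b x → ∃[ k ] k < p × x ≡ suc y + k * a
    to x-gap@((_ , _ , _ , x∉S , _) , x%a)
      with k , x≡ ← same-residue⇒≡+* a (lowest x x-gap) (trans x%a (sym h%a)) =
      k , ≰⇒> (λ p≤k → x∉S (subst _∈S (sym x≡) (beyond-depth-∈S depth p≤k))) , x≡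
    from : ∃[ k ] k < p × x ≡ suc y + k * a → InI i a b x
    from (k , k<p , refl) =
      (y + k * a , refl , +-*a-∈S k y∈S , below-depth-∉S depth k<p , +-*a-∈S k h+1∈S) ,
      trans ([m+kn]%n≡m%n (suc y) k a) h%a

proposition4p7 : (a b : ℕ) .{{_ : NonZero a}} → 1 < a → a < b → Coprime a b →
    (u v : ℤ) → DefinitelyLeast a b u v →
    (i : ℕ) → 1 ≤ i → i ≤ a ∸ 1 →
    (h : ℕ) → InI i a b h → (∀ x → InI i a b x → h ≤ x) →
    ∀ x → InI i a b x ⇔ (∃[ k ] (k < ∣ u ∣) × (x ≡ h + k * a))
proposition4p7 a b 1<a a<b coprime u v (sol , least) i _ _ h h-gap h-lowest =
  lowest-isolated-gaps lowest (lowest-depth ∣ u ∣ ∣ v ∣ lowest (solution⇒adjacent a b u v sol) 2∣u∣≤b)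
  where
  open TwoGenerated a b coprime
  lowest : Lowest i h
  lowest = h-gap , h-lowest
  shifted : IsSolution a b (u ℤ.- + b) (v ℤ.+ + a) × IsSolution a b (u ℤ.+ + b) (v ℤ.- + a)
  shifted = shifted-solutions a b u v sol
  2∣u∣≤b : ∣ u ∣ + ∣ u ∣ ≤ b
  2∣u∣≤b = ∣i∣≤∣i∓n∣⇒∣i∣+∣i∣≤n u (<-trans (<-trans z<s 1<a) a<b)
             (proj₁ (least (u ℤ.- + b) (v ℤ.+ + a) (proj₁ shifted)))
             (proj₁ (least (u ℤ.+ + b) (v ℤ.- + a) (proj₂ shifted)))
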